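{- Let $\beta>1$ be a non-simple Parry number with $d_\beta(1)=t_1\cdots t_m(t_{m+1}\cdots t_{m+p})^\omega$ ($m,p\ge1$ least possible). Then $\beta\in\mathcal S$ if and only if one of the following holds: (a) $t_{m+1}=t_{m+2}=\cdots=t_{m+p-1}=0$ (i.e. $d_\beta(1)=t_1\cdots t_m(0\cdots0\,t_{m+p})^\omega$) and $t_m>t_{m+p}$; (b) there is an integer $q\ge1$ with $m-qp\ge1$, $t_{m-qp}\neq0$ and $t_{m-qp+1}=\cdots=t_{m-1}=0$ (i.e. $d_\beta(1)=t_1\cdots t_{m-qp}0^{qp-1}t_m(t_{m+1}\cdots t_{m+p})^\omega$), and $t_m<t_{m+p}$.
   Context: For real $\beta>1$, $d_\beta(1)=t_1t_2\cdots$ with $t_i=\lfloor\beta T_\beta^{i-1}(1)\rfloor$, $T_\beta(x)=\{\beta x\}$, $T_\beta^0(1)=1$. $\beta$ is a non-simple Parry number if $d_\beta(1)$ is eventually periodic with infinitely many nonzero digits; then $m,p\ge1$ are taken least possible, so $t_m\neq t_{m+p}$, and the Parry condition $t_jt_{j+1}\cdots\prec t_1t_2\cdots$ (strict lexicographic) holds for all $j>1$ (in particular $t_{m+p}<t_m$ if $m=1$). For $1\le k\le m+p-1$ let $z(k)=\max\{j\in\mathbb N:0^j\text{ is a suffix of }t_1\cdots t_k\}$. Put $z=1+z(m-1)$ if $t_m<t_{m+p}$ and $z=1+z(m+p-1)$ if $t_{m+p}<t_m$. By definition $\beta\in\mathcal S$ iff $z=sp$ for some positive integer $s$. -}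

module Defs where

open import Data.Nat using (ℕ; zero; suc; _+_; _*_; _∸_; _≤_; _<_; _<ᵇ_)
open import Data.Bool using (if_then_else_)
open import Data.Product using (Σ; ∃; _×_)
open import Relation.Binary.PropositionalEquality using (_≡_; _≢_)

-- A digit sequence t₁ t₂ t₃ … is represented as a function t : ℕ → ℕ,
-- using only the positive indices (t 0 is ignored).

PeriodicFrom : (ℕ → ℕ) → ℕ → ℕ → Set
PeriodicFrom t m p = ∀ i → m < i → t (i + p) ≡ t i

LeastPreperiodPeriod : (ℕ → ℕ) → ℕ → ℕ → Set
LeastPreperiodPeriod t m p =
  1 ≤ m × 1 ≤ p × PeriodicFrom t m p ×
  (∀ m' p' → 1 ≤ m' → 1 ≤ p' → PeriodicFrom t m' p' → m ≤ m' × p ≤ p')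

InfinitelyManyNonzero : (ℕ → ℕ) → Set
InfinitelyManyNonzero t = ∀ N → ∃ λ i → N < i × t i ≢ 0

ShiftLexLess : (ℕ → ℕ) → ℕ → Set
ShiftLexLess t j =
  ∃ λ n → (∀ k → k < n → t (j + k) ≡ t (1 + k)) × t (j + n) < t (1 + n)

ParryCondition : (ℕ → ℕ) → Set
ParryCondition t = ∀ j → 1 < j → ShiftLexLess t j

-- t = d_β(1) for a non-simple Parry number β > 1 with least (m , p)
-- (by Parry's characterisation of the sequences d_β(1); t₁ = ⌊β⌋ ≥ 1)
NonSimpleParryExpansion : (ℕ → ℕ) → ℕ → ℕ → Set
NonSimpleParryExpansion t m p =
  1 ≤ t 1 × ParryCondition t × InfinitelyManyNonzero t × LeastPreperiodPeriod t m p

zeroSuffix : (ℕ → ℕ) → ℕ → ℕ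
zeroSuffix t zero = 0
zeroSuffix t (suc k) with t (suc k)
... | zero = suc (zeroSuffix t k)
... | suc _ = 0

-- z = 1 + z(m-1) if t_m < t_{m+p}, and z = 1 + z(m+p-1) if t_{m+p} < t_m
-- (t_m ≠ t_{m+p} by minimality of m)
zVal : (ℕ → ℕ) → ℕ → ℕ → ℕ
zVal t m p =
  if t m <ᵇ t (m + p)
  then suc (zeroSuffix t (m ∸ 1))
  else suc (zeroSuffix t (m + p ∸ 1))

-- β ∈ 𝒮  iff  z = s p for some positive integer s
InS : (ℕ → ℕ) → ℕ → ℕ → Set
InS t m p = ∃ λ s → 1 ≤ s × zVal t m p ≡ s * p

CondA : (ℕ → ℕ) → ℕ → ℕ → Set
CondA t m p = (∀ i → m < i → i < m + p → t i ≡ 0) × t (m + p) < t m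

CondB : (ℕ → ℕ) → ℕ → ℕ → Set
CondB t m p =
  ∃ λ q → 1 ≤ q × 1 ≤ m ∸ q * p × q * p < m × t (m ∸ q * p) ≢ 0 ×
    (∀ i → m ∸ q * p < i → i < m → t i ≡ 0) × t m < t (m + p)

{-# OPTIONS --safe #-}
-- z − 1 is the length of the run of zeros ending at position m − 1 (if t_m < t_{m+p}) or
-- m + p − 1 (if t_{m+p} < t_m).  In the first case the run is preceded by a nonzero digit
-- (t_1 ≠ 0 and m ≥ 2), namely t_{m−z}, so z = qp is literally condition (b).  In the second
-- case t_m ≠ 0 caps the run, so z ≤ p, and z is a positive multiple of p iff z = p, i.e. iff
-- t_{m+1} = ⋯ = t_{m+p−1} = 0.  Minimality of m and the Parry condition rule out
-- t_m = t_{m+p} (the sequence would be periodic from m − 1, purely periodic if m = 1), and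
-- the Parry condition t_{1+p} ≤ t_1 rules out m = 1 in the first case.
module Submission where

open import Defs
open import Data.Nat using (ℕ; zero; suc; _+_; _*_; _∸_; _≤_; _<_; _<ᵇ_; z≤n; s≤s; z<s)
open import Data.Nat.Properties
open import Data.Bool using (true; false; T)
open import Data.Unit using (tt)
open import Data.Product using (∃; _×_; _,_; proj₁)
open import Data.Sum using (_⊎_; inj₁; inj₂; [_,_])
open import Function using (id; _∘_)
open import Function.Bundles using (_⇔_; mk⇔; Equivalence)
open import Function.Construct.Composition using (_⇔-∘_)
open import Relation.Binary using (tri<; tri≈; tri>)
open import Relation.Binary.PropositionalEquality using (_≡_; _≢_; refl; sym; trans; cong; subst)
open import Relation.Nullary using (¬_; contradiction)

ZeroBlockBefore : (ℕ → ℕ) → ℕ → ℕ → Set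
ZeroBlockBefore t m n = n < m × t (m ∸ n) ≢ 0 × (∀ i → m ∸ n < i → i < m → t i ≡ 0)

module _ (t : ℕ → ℕ) where

  zeroSuffix-zeros : ∀ k i → k ∸ zeroSuffix t k < i → i ≤ k → t i ≡ 0
  zeroSuffix-zeros zero i h h′ = contradiction (≤-trans h h′) λ ()
  zeroSuffix-zeros (suc k) i h h′ with t (suc k) in eq
  ... | suc _ = contradiction h′ (<⇒≱ h)
  ... | zero with m≤n⇒m<n∨m≡n h′
  ...   | inj₁ i<1+k = zeroSuffix-zeros k i h (≤-pred i<1+k)
  ...   | inj₂ refl = eq

  zeroSuffix-nonzero : ∀ k → zeroSuffix t k < k → t (k ∸ zeroSuffix t k) ≢ 0
  zeroSuffix-nonzero (suc k) h with t (suc k) in eq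
  ... | zero = zeroSuffix-nonzero k (≤-pred h)
  ... | suc _ = λ e → contradiction (trans (sym eq) e) λ ()

  zeroSuffix[1+k]≤k : t 1 ≢ 0 → ∀ k → zeroSuffix t (suc k) ≤ k
  zeroSuffix[1+k]≤k t₁≢0 zero with t 1
  ... | zero = contradiction refl t₁≢0
  ... | suc _ = z≤n
  zeroSuffix[1+k]≤k t₁≢0 (suc k) with t (suc (suc k))
  ... | zero = s≤s (zeroSuffix[1+k]≤k t₁≢0 k)
  ... | suc _ = z≤n

  zeroSuffix≤∸ : ∀ {i} k → t i ≢ 0 → i ≤ k → zeroSuffix t k ≤ k ∸ i
  zeroSuffix≤∸ zero _ _ = z≤n
  zeroSuffix≤∸ {i} (suc k) tᵢ≢0 i≤1+k with t (suc k) in eq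
  ... | suc _ = z≤n
  ... | zero with m≤n⇒m<n∨m≡n i≤1+k
  ...   | inj₂ refl = contradiction eq tᵢ≢0
  ...   | inj₁ i<1+k = begin
    suc (zeroSuffix t k) ≤⟨ s≤s (zeroSuffix≤∸ k tᵢ≢0 (≤-pred i<1+k)) ⟩
    suc (k ∸ i)          ≡⟨ +-∸-assoc 1 (≤-pred i<1+k) ⟨
    suc k ∸ i            ∎
    where open ≤-Reasoning

  zeroSuffix-unique : ∀ k j → j < k → t (k ∸ j) ≢ 0 →
    (∀ i → k ∸ j < i → i ≤ k → t i ≡ 0) → zeroSuffix t k ≡ j
  zeroSuffix-unique (suc k) zero _ nz _ with t (suc k)
  ... | zero = contradiction refl nz
  ... | suc _ = refl
  zeroSuffix-unique (suc k) (suc j) j<k nz zeros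
    with t (suc k) | zeros (suc k) (s≤s (m∸n≤m k j)) ≤-refl
  ... | zero | _ = cong suc (zeroSuffix-unique k j (≤-pred j<k) nz
                              λ i h h′ → zeros i h (m≤n⇒m≤1+n h′))

  suc-zeroSuffix≡⇔ZeroBlockBefore : t 1 ≢ 0 → ∀ {k n} → 1 < k → 1 ≤ n →
    suc (zeroSuffix t (k ∸ 1)) ≡ n ⇔ ZeroBlockBefore t k n
  suc-zeroSuffix≡⇔ZeroBlockBefore _ {suc zero} (s≤s ()) _
  suc-zeroSuffix≡⇔ZeroBlockBefore t₁≢0 {suc (suc k)} {suc j} _ _ = mk⇔ to from
    where
    to : suc (zeroSuffix t (suc k)) ≡ suc j → ZeroBlockBefore t (suc (suc k)) (suc j)
    to refl = s≤s z<k , zeroSuffix-nonzero (suc k) z<k ,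
              λ i h h′ → zeroSuffix-zeros (suc k) i h (≤-pred h′)
      where z<k = s≤s (zeroSuffix[1+k]≤k t₁≢0 k)
    from : ZeroBlockBefore t (suc (suc k)) (suc j) → suc (zeroSuffix t (suc k)) ≡ suc j
    from (j<k , nz , zeros) =
      cong suc (zeroSuffix-unique (suc k) j (≤-pred j<k) nz λ i h h′ → zeros i h (s≤s h′))

  zeroSuffix<distance : ∀ {i} k → t i ≢ 0 → i < k → suc (zeroSuffix t (k ∸ 1)) ≤ k ∸ i
  zeroSuffix<distance {i} (suc k) tᵢ≢0 i<1+k =
    subst (suc (zeroSuffix t k) ≤_) (sym (+-∸-assoc 1 i≤k)) (s≤s (zeroSuffix≤∸ k tᵢ≢0 i≤k))
    where i≤k = ≤-pred i<1+k

  ZeroBlockBefore[m+p]p⇔ : ∀ {m} p → 1 ≤ m → t m ≢ 0 →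
    ZeroBlockBefore t (m + p) p ⇔ (∀ i → m < i → i < m + p → t i ≡ 0)
  ZeroBlockBefore[m+p]p⇔ {m} p 1≤m tₘ≢0 = mk⇔
    (λ (_ , _ , zeros) i m<i → zeros i (subst (_< i) (sym m+p∸p≡m) m<i))
    (λ zeros → m<n+m p 1≤m , subst (λ j → t j ≢ 0) (sym m+p∸p≡m) tₘ≢0 ,
               λ i h → zeros i (subst (_< i) m+p∸p≡m h))
    where m+p∸p≡m = m+n∸n≡m m p

positiveMultiple⇔≡ : ∀ {n p} → n ≤ p → (∃ λ s → 1 ≤ s × n ≡ s * p) ⇔ n ≡ p
positiveMultiple⇔≡ {n} {p} n≤p = mk⇔
  (λ { (suc s , _ , refl) → ≤-antisym n≤p (m≤m+n p (s * p)) })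
  (λ n≡p → 1 , ≤-refl , trans n≡p (sym (*-identityˡ p)))

zVal-ascent : ∀ t m p → t m < t (m + p) → zVal t m p ≡ suc (zeroSuffix t (m ∸ 1))
zVal-ascent t m p lt with t m <ᵇ t (m + p) | <⇒<ᵇ lt
... | true | _ = refl

zVal-descent : ∀ t m p → t (m + p) < t m → zVal t m p ≡ suc (zeroSuffix t (m + p ∸ 1))
zVal-descent t m p gt with t m <ᵇ t (m + p) in eq
... | false = refl
... | true = contradiction (<ᵇ⇒< (t m) (t (m + p)) (subst T (sym eq) tt)) (<⇒≯ gt)

InS⇔CondB-ascent : ∀ {t m p} → t 1 ≢ 0 → 1 < m → 1 ≤ p → t m < t (m + p) →
  InS t m p ⇔ CondB t m p
InS⇔CondB-ascent {t} {m} {p} t₁≢0 1<m 1≤p lt = mk⇔ to from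
  where
  block⇔ : ∀ {q} → 1 ≤ q → suc (zeroSuffix t (m ∸ 1)) ≡ q * p ⇔ ZeroBlockBefore t m (q * p)
  block⇔ 1≤q = suc-zeroSuffix≡⇔ZeroBlockBefore t t₁≢0 1<m (*-mono-≤ 1≤q 1≤p)
  to : InS t m p → CondB t m p
  to (q , 1≤q , eq) with Equivalence.to (block⇔ 1≤q) (trans (sym (zVal-ascent t m p lt)) eq)
  ... | qp<m , nz , zeros = q , 1≤q , m<n⇒0<n∸m qp<m , qp<m , nz , zeros , lt
  from : CondB t m p → InS t m p
  from (q , 1≤q , _ , qp<m , nz , zeros , _) =
    q , 1≤q , trans (zVal-ascent t m p lt) (Equivalence.from (block⇔ 1≤q) (qp<m , nz , zeros))

InS⇔CondA-descent : ∀ {t m p} → t 1 ≢ 0 → 1 ≤ m → 1 ≤ p → t (m + p) < t m →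
  InS t m p ⇔ CondA t m p
InS⇔CondA-descent {t} {m} {p} t₁≢0 1≤m 1≤p gt = mk⇔ to from
  where
  tₘ≢0 : t m ≢ 0
  tₘ≢0 = m<n⇒n≢0 gt
  z≤p : suc (zeroSuffix t (m + p ∸ 1)) ≤ p
  z≤p = subst (suc (zeroSuffix t (m + p ∸ 1)) ≤_) (m+n∸m≡n m p)
              (zeroSuffix<distance t (m + p) tₘ≢0 (m<m+n m 1≤p))
  zeros⇔ : suc (zeroSuffix t (m + p ∸ 1)) ≡ p ⇔ (∀ i → m < i → i < m + p → t i ≡ 0)
  zeros⇔ = ZeroBlockBefore[m+p]p⇔ t p 1≤m tₘ≢0
       ⇔-∘ suc-zeroSuffix≡⇔ZeroBlockBefore t t₁≢0 (+-mono-≤ 1≤m 1≤p) 1≤p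
  to : InS t m p → CondA t m p
  to (s , 1≤s , eq) = Equivalence.to (zeros⇔ ⇔-∘ positiveMultiple⇔≡ z≤p)
                        (s , 1≤s , trans (sym (zVal-descent t m p gt)) eq) , gt
  from : CondA t m p → InS t m p
  from (zeros , _) with Equivalence.from (zeros⇔ ⇔-∘ positiveMultiple⇔≡ z≤p) zeros
  ... | s , 1≤s , eq = s , 1≤s , trans (zVal-descent t m p gt) eq

module _ (t : ℕ → ℕ) (parry : ParryCondition t) where

  Parry⇒digit≤first : ∀ j → 1 < j → t j ≤ t 1
  Parry⇒digit≤first j 1<j with parry j 1<j
  ... | zero , _ , lt = subst (λ i → t i ≤ t 1) (+-identityʳ j) (<⇒≤ lt)
  ... | suc _ , agree , _ = subst (λ i → t i ≤ t 1) (+-identityʳ j) (≤-reflexive (agree 0 z<s))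

  Parry⇒¬PeriodicFrom0 : ∀ {p} → 1 ≤ p → ¬ PeriodicFrom t 0 p
  Parry⇒¬PeriodicFrom0 {p} 1≤p periodic with parry (1 + p) (s≤s 1≤p)
  ... | n , _ , lt = <-irrefl (trans (cong (t ∘ suc) (+-comm p n)) (periodic (suc n) z<s)) lt

  Parry⇒ascent⇒1<m : ∀ {m p} → 1 ≤ m → 1 ≤ p → t m < t (m + p) → 1 < m
  Parry⇒ascent⇒1<m {suc zero} {p} _ 1≤p lt =
    contradiction lt (≤⇒≯ (Parry⇒digit≤first (1 + p) (s≤s 1≤p)))
  Parry⇒ascent⇒1<m {suc (suc _)} _ _ _ = s≤s (s≤s z≤n)

  PeriodicFrom-pred : ∀ {m p} → PeriodicFrom t (suc m) p → t (suc m + p) ≡ t (suc m) →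
    PeriodicFrom t m p
  PeriodicFrom-pred periodic eq i m<i with m≤n⇒m<n∨m≡n m<i
  ... | inj₁ 1+m<i = periodic i 1+m<i
  ... | inj₂ refl = eq

  Parry⇒preperiodDigitsDiffer : ∀ {m p} → LeastPreperiodPeriod t m p → t m ≢ t (m + p)
  Parry⇒preperiodDigitsDiffer {suc zero} (_ , 1≤p , periodic , _) eq =
    Parry⇒¬PeriodicFrom0 1≤p (PeriodicFrom-pred periodic (sym eq))
  Parry⇒preperiodDigitsDiffer {suc (suc m)} {p} (_ , 1≤p , periodic , least) eq =
    1+n≰n (proj₁ (least (suc m) p z<s 1≤p (PeriodicFrom-pred periodic (sym eq))))

⊎-absurdˡ-⇔ : ∀ {A B : Set} → ¬ A → B ⇔ (A ⊎ B)
⊎-absurdˡ-⇔ ¬a = mk⇔ inj₂ [ (λ a → contradiction a ¬a) , id ]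

⊎-absurdʳ-⇔ : ∀ {A B : Set} → ¬ B → A ⇔ (A ⊎ B)
⊎-absurdʳ-⇔ ¬b = mk⇔ inj₁ [ id , (λ b → contradiction b ¬b) ]

mainTheorem9 : (t : ℕ → ℕ) (m p : ℕ) → NonSimpleParryExpansion t m p →
    InS t m p ⇔ (CondA t m p ⊎ CondB t m p)
mainTheorem9 t m p (1≤t₁ , parry , _ , least@(1≤m , 1≤p , _))
  with <-cmp (t m) (t (m + p))
... | tri< lt _ _ = ⊎-absurdˡ-⇔ (λ (_ , gt) → <-asym lt gt)
                ⇔-∘ InS⇔CondB-ascent t₁≢0 (Parry⇒ascent⇒1<m t parry 1≤m 1≤p lt) 1≤p lt
  where t₁≢0 = m<n⇒n≢0 1≤t₁
... | tri≈ _ eq _ = contradiction eq (Parry⇒preperiodDigitsDiffer t parry least)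
... | tri> _ _ gt = ⊎-absurdʳ-⇔ (λ (_ , _ , _ , _ , _ , _ , lt) → <-asym gt lt)
                ⇔-∘ InS⇔CondA-descent (m<n⇒n≢0 1≤t₁) 1≤m 1≤p gt
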